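{- Let $R$ be a commutative ring, let $g,h\in R$, and let $Q(x,y)=x^2+gxy+hy^2$. If $x,y\in R$ satisfy $Rx+Ry=R$ (i.e. there exist $a,b\in R$ with $ax+by=1$), then there exists $z\in R$ such that $Q(x,y)$ divides $Q(z,1)=z^2+gz+h$ in $R$.
   Context: $Rx+Ry$ denotes the ideal of $R$ generated by $x$ and $y$. -}

module Defs where

open import Level using (_⊔_)
open import Algebra.Bundles using (CommutativeRing)
import Algebra.Definitions.RawMagma as RawMagmaDefs

module _ {c ℓ} (R : CommutativeRing c ℓ) where
  open CommutativeRing R

  _∣ᴿ_ : Carrier → Carrier → Set (c ⊔ ℓ)
  _∣ᴿ_ = RawMagmaDefs._∣_ *-rawMagma

  Q : Carrier → Carrier → Carrier → Carrier → Carrier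
  Q g h x y = x * x + g * x * y + h * y * y

-- Squaring a x + b y = 1 gives a² Q(x, y) + t y = 1 for an explicit t, so y is invertible
-- modulo Q(x, y) with inverse t. Dehomogenising by this inverse, i.e. taking z = t x, gives
-- Q(t x, 1) ≡ t² Q(x, y) ≡ 0 modulo Q(x, y).
module Submission where

open import Defs
open import Data.Product using (∃; ∃-syntax; _,_)
open import Algebra.Bundles using (CommutativeRing)
import Algebra.Definitions.RawMagma as RawMagmaDefs
import Algebra.Properties.Group as GroupProperties
import Algebra.Properties.Ring as RingProperties
import Algebra.Solver.Ring.NaturalCoefficients.Default as NaturalCoefficientsSolver
import Relation.Binary.Reasoning.Setoid as SetoidReasoning

module QuadraticFormProperties {c ℓ} (R : CommutativeRing c ℓ) where
  open CommutativeRing R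
  open GroupProperties +-group using (∙-cancelʳ; //-rightDividesʳ)
  open RingProperties ring using ([y-z]x≈yx-zx)
  open NaturalCoefficientsSolver commutativeSemiring
  open SetoidReasoning setoid
  open RawMagmaDefs *-rawMagma using (_∣_; _,_)

  -- Q(t x, u) ≡ t² Q(x, y) modulo u - t y, with the cofactor moved across since the solver
  -- only proves semiring identities.
  Q-dehomogenise : ∀ g h x y t u →
    Q R g h (t * x) u + t * y * (g * t * x + h * (u + t * y))
      ≈ t * t * Q R g h x y + u * (g * t * x + h * (u + t * y))
  Q-dehomogenise = solve 6 (λ g h x y t u →
    (t :* x) :* (t :* x) :+ g :* (t :* x) :* u :+ h :* u :* u
      :+ t :* y :* (g :* t :* x :+ h :* (u :+ t :* y))
    := t :* t :* (x :* x :+ g :* x :* y :+ h :* y :* y)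
      :+ u :* (g :* t :* x :+ h :* (u :+ t :* y)))
    refl

  Q∣Q[tx,1] : ∀ g h x y s t → s * Q R g h x y + t * y ≈ 1# →
              Q R g h x y ∣ Q R g h (t * x) 1#
  Q∣Q[tx,1] g h x y s t sN+ty≈1 = t * t + s * W , sym (∙-cancelʳ (t * y * W) _ _ (begin
    Q R g h (t * x) 1# + t * y * W ≈⟨ Q-dehomogenise g h x y t 1# ⟩
    t * t * N + 1# * W             ≈⟨ +-congˡ (*-congʳ sN+ty≈1) ⟨
    t * t * N + (s * N + t * y) * W
      ≈⟨ solve 5 (λ t s N W ty → t :* t :* N :+ (s :* N :+ ty) :* W
                                 := (t :* t :+ s :* W) :* N :+ ty :* W) refl t s N W (t * y) ⟩
    (t * t + s * W) * N + t * y * W ∎))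
    where
    N W : Carrier
    N = Q R g h x y
    W = g * t * x + h * (1# + t * y)

  -- Read off from expanding (a x + b y)² modulo y.
  inverseModQ : ∀ g h x y a b → Carrier
  inverseModQ g h x y a b = b * (a * x + a * x + b * y) - a * a * (g * x + h * y)

  unimodular-square-identity : ∀ g h x y a b →
    (a * x + b * y) * (a * x + b * y) + a * a * (g * x + h * y) * y
      ≈ a * a * Q R g h x y + b * (a * x + a * x + b * y) * y
  unimodular-square-identity = solve 6 (λ g h x y a b →
    (a :* x :+ b :* y) :* (a :* x :+ b :* y) :+ a :* a :* (g :* x :+ h :* y) :* y
    := a :* a :* (x :* x :+ g :* x :* y :+ h :* y :* y) :+ b :* (a :* x :+ a :* x :+ b :* y) :* y)
    refl

  unimodular⇒invertibleModQ : ∀ g h x y a b → a * x + b * y ≈ 1# →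
    a * a * Q R g h x y + inverseModQ g h x y a b * y ≈ 1#
  unimodular⇒invertibleModQ g h x y a b ax+by≈1 = begin
    a * a * Q R g h x y + (B - A) * y                  ≈⟨ +-congˡ ([y-z]x≈yx-zx y B A) ⟩
    a * a * Q R g h x y + (B * y - A * y)              ≈⟨ +-assoc _ _ _ ⟨
    a * a * Q R g h x y + B * y - A * y                ≈⟨ +-congʳ (unimodular-square-identity g h x y a b) ⟨
    (a * x + b * y) * (a * x + b * y) + A * y - A * y  ≈⟨ //-rightDividesʳ (A * y) _ ⟩
    (a * x + b * y) * (a * x + b * y)                  ≈⟨ *-cong ax+by≈1 ax+by≈1 ⟩
    1# * 1#                                            ≈⟨ *-identityˡ 1# ⟩
    1#                                                 ∎
    where
    A B : Carrier
    A = a * a * (g * x + h * y)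
    B = b * (a * x + a * x + b * y)

proposition3p1 : ∀ {c ℓ} (R : CommutativeRing c ℓ) →
    let open CommutativeRing R in
    (g h x y : Carrier) →
    (∃[ a ] ∃[ b ] (a * x + b * y ≈ 1#)) →
    ∃[ z ] (_∣ᴿ_ R (Q R g h x y) (Q R g h z 1#))
proposition3p1 R g h x y (a , b , ax+by≈1) =
  t * x , Q∣Q[tx,1] g h x y (a * a) t (unimodular⇒invertibleModQ g h x y a b ax+by≈1)
  where
  open CommutativeRing R using (Carrier; _*_)
  open QuadraticFormProperties R
  t : Carrier
  t = inverseModQ g h x y a b
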